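{- Fix $\eta>0$ and an integer $k\ge2$. There is $K>0$ such that every $k$-uniform contracted absorber $H$ with girth at least $K$ satisfies $m_k(H)\le 2/k+\eta$.
   Context: An absorber rooted on a $k$-tuple of vertices $(x_1,\dots,x_k)$ is a $k$-graph on a vertex set containing $x_1,\dots,x_k$ whose edges can be partitioned into a perfect matching of its vertex set and a matching covering exactly the vertices other than $x_1,\dots,x_k$. A contracted absorber rooted at $(x_1,\dots,x_k)$ is a union of $k-1$ absorbers each rooted at $(x_1,\dots,x_k)$, pairwise vertex-disjoint except for the vertices $x_1,\dots,x_k$. A (Berge) cycle of length $\ell\ge2$ is a sequence of distinct edges $e_1,\dots,e_\ell$ for which there exist distinct vertices $v_1,\dots,v_\ell$ with $v_i\in e_i\cap e_{i+1}$ for all $i$ (indices mod $\ell$, $e_{\ell+1}=e_1$); the girth is the minimum length of a cycle (infinite if there is none). The $k$-density is $m_k(H)=\max\{(e(H')-1)/(v(H')-k): H'\subseteq H,\ v(H')>k\}$, where $e(\cdot)$, $v(\cdot)$ denote numbers of edges and vertices.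
   Formalization: The parameter η ranges over the positive rationals. -}

module Defs where

open import Data.Nat as ℕ using (ℕ; zero; suc; _<_; _≤_; _∸_)
open import Data.Integer as ℤ using (ℤ; +_)
open import Data.Rational as ℚ using (ℚ; 0ℚ)
open import Data.Fin as Fin using (Fin; toℕ; fromℕ<)
open import Data.Fin.Subset using (Subset; _∈_; _∉_; _∩_; ∣_∣)
open import Data.List using (List; length; _++_; lookup)
open import Data.List.Membership.Propositional using () renaming (_∈_ to _∈ₗ_)
open import Data.List.Relation.Unary.All using (All)
open import Data.List.Relation.Unary.Unique.Propositional using (Unique)
open import Data.List.Relation.Binary.Permutation.Propositional using (_↭_)
open import Data.Product using (Σ; ∃; _×_; _,_)
open import Data.Sum using (_⊎_)
open import Function.Definitions using (Injective)
open import Relation.Binary.PropositionalEquality using (_≡_; _≢_)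
open import Relation.Nullary using (¬_; yes; no)

record Hypergraph (k n : ℕ) : Set where
  field
    edges    : List (Subset n)
    unique   : Unique edges
    uniform  : All (λ e → ∣ e ∣ ≡ k) edges
open Hypergraph public

Disjoint : ∀ {n} → Subset n → Subset n → Set
Disjoint {n} e f = (x : Fin n) → x ∈ e → x ∉ f

MatchingCovering : ∀ {n} → List (Subset n) → (Fin n → Set) → Set
MatchingCovering {n} M W =
  ((e f : Fin (length M)) → e ≢ f →
     Disjoint (lookup M e) (lookup M f))
  × All (λ e → (x : Fin n) → x ∈ e → W x) M
  × ((x : Fin n) → W x → ∃ λ e → e ∈ₗ M × x ∈ e)

IsRoot : ∀ {k n} → (Fin k → Fin n) → Fin n → Set
IsRoot {k} r x = ∃ λ (i : Fin k) → r i ≡ x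

record Absorber (k n : ℕ) (r : Fin k → Fin n) : Set where
  field
    V        : Subset n
    E        : List (Subset n)
    E-unique : Unique E
    E-unif   : All (λ e → ∣ e ∣ ≡ k) E
    E-in-V   : All (λ e → (x : Fin n) → x ∈ e → x ∈ V) E
    roots-in : (i : Fin k) → r i ∈ V
    M₁ M₂    : List (Subset n)
    split    : E ↭ (M₁ ++ M₂)
    M₁-perf  : MatchingCovering M₁ (λ x → x ∈ V)
    M₂-cover : MatchingCovering M₂ (λ x → x ∈ V × ¬ IsRoot r x)
open Absorber public

IsContractedAbsorber : ∀ {k n} → Hypergraph k n → Set
IsContractedAbsorber {k} {n} H =
  Σ (Fin k → Fin n) λ r → Injective _≡_ _≡_ r ×
  Σ (Fin (k ∸ 1) → Absorber k n r) λ A →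
    ((i j : Fin (k ∸ 1)) → i ≢ j → (x : Fin n) →
       x ∈ V (A i) → x ∈ V (A j) → IsRoot r x)
    × ((x : Fin n) → ∃ λ i → x ∈ V (A i))
    × ((e : Subset n) →
         (e ∈ₗ edges H → ∃ λ i → e ∈ₗ E (A i))
         × ((∃ λ i → e ∈ₗ E (A i)) → e ∈ₗ edges H))

next : ∀ {m} → Fin (suc m) → Fin (suc m)
next {m} i with suc (toℕ i) ℕ.<? suc m
... | yes p = fromℕ< p
... | no _  = Fin.zero

BergeCycle : ∀ {k n} → Hypergraph k n → ℕ → Set
BergeCycle {k} {n} H ℓ =
  2 ≤ ℓ × Σ ℕ λ m → ℓ ≡ suc m ×
  Σ (Fin (suc m) → Fin (length (edges H))) λ ed → Injective _≡_ _≡_ ed ×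
  Σ (Fin (suc m) → Fin n) λ v → Injective _≡_ _≡_ v ×
  ((i : Fin (suc m)) → (v i ∈ lookup (edges H) (ed i))
                      × (v i ∈ lookup (edges H) (ed (next i))))

GirthAtLeast : ∀ {k n} → Hypergraph k n → ℕ → Set
GirthAtLeast H K = (ℓ : ℕ) → ℓ < K → ¬ BergeCycle H ℓ

-- a/d as a rational; only used with d > 0 (value 0 at d = 0 is a dummy)
frac : ℤ → ℕ → ℚ
frac a zero    = 0ℚ
frac a (suc d) = a ℚ./ suc d

record SubHypergraph {k n : ℕ} (H : Hypergraph k n) : Set where
  field
    W        : Subset n
    F        : List (Subset n)
    F-unique : Unique F
    F-sub    : All (λ e → e ∈ₗ edges H) F
    F-in-W   : All (λ e → (x : Fin n) → x ∈ e → x ∈ W) F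
open SubHypergraph public

-- m_k(H) ≤ b, unfolding the maximum in the definition of m_k:
-- every H' ⊆ H with v(H') > k has (e(H') - 1)/(v(H') - k) ≤ b.
kDensityAtMost : ∀ {k n} → Hypergraph k n → ℚ → Set
kDensityAtMost {k} H b =
  (H' : SubHypergraph H) → k < ∣ W H' ∣ →
    frac ((+ length (F H')) ℤ.- (+ 1)) (∣ W H' ∣ ∸ k) ℚ.≤ b

module Submission where

-- Let H' ⊆ H have f edges and k + d vertices (d ≥ 1).  Two counting facts
-- about H' drive the proof.
--  * Degree count: in a contracted absorber a non-root vertex lies in at
--    most two edges (one of each matching of its absorber) and a root in at
--    most k - 1, so double counting incidences gives  k·f ≤ 2(k + d) + k².
--  * Forest count: a k-uniform edge set without cycles satisfies
--    (k - 1)·f + 1 ≤ k + d.  It is proved by removing a leaf edge (one with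
--    at most one vertex shared with other edges); if no leaf exists, a
--    non-backtracking walk along shared vertices closes a short cycle.
-- With D the denominator of η, if d ≥ (k+1)·D the degree count already gives
-- (f-1)/d ≤ 2/k + 1/D; otherwise f is bounded in terms of k and D, so a
-- girth threshold K(k, D) makes H' acyclic and the forest count gives
-- (f-1)/d ≤ 1/(k-1) ≤ 2/k.  Finally 1/D ≤ η.

module Combinatorics where

  open import Defs
  open import Data.Nat as ℕ using (ℕ; zero; suc; _≤_; _<_; s≤s; z≤n; _+_; _*_; _∸_)
  import Data.Nat.Properties as ℕP
  open import Algebra.Properties.Semiring.Sum ℕP.+-*-semiring
    using (sum-syntax; sum-cong-≗; ∑-distrib-+; ∑-comm; *-distribˡ-sum; sum-replicate-zero)
  open import Data.Fin as Fin using (Fin; toℕ)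
  import Data.Fin.Properties as FinP
  open import Data.Fin.Subset using (Subset; _∈_; _∉_; ∣_∣)
  open import Data.Fin.Subset.Properties using (_∈?_; drop-there)
  open import Data.Bool using (true; false)
  import Data.Bool as Bool
  import Data.Vec.Base as Vec
  import Data.Vec.Properties as VecP
  open import Data.List using (List; []; _∷_; length; lookup; tabulate)
  open import Data.List.Properties using (length-tabulate)
  open import Data.List.Membership.Propositional using (find; lose) renaming (_∈_ to _∈ₗ_)
  open import Data.List.Membership.Propositional.Properties
    using (∈-tabulate⁺; ∈-++⁻)
  open import Data.List.Relation.Binary.Permutation.Propositional.Properties using (∈-resp-↭)
  open import Data.List.Relation.Unary.Any using (Any; here; there; any?)
  import Data.List.Relation.Unary.Any as Any
  import Data.List.Relation.Unary.Any.Properties as AnyP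
  open import Data.List.Relation.Unary.All using (All; []; _∷_)
  import Data.List.Relation.Unary.All as All
  open import Data.List.Relation.Unary.Unique.Propositional using (Unique)
  open import Data.List.Relation.Unary.AllPairs using (_∷_)
  open import Data.Product using (Σ; ∃; ∃₂; _×_; _,_; proj₁; proj₂)
  open import Data.Sum using (_⊎_; inj₁; inj₂)
  open import Data.Empty using (⊥-elim)
  open import Function.Definitions using (Injective)
  open import Relation.Nullary using (¬_; Dec; yes; no; _×-dec_; _⊎-dec_; ¬?)
  open import Relation.Unary using (Pred; Decidable)
  open import Relation.Binary.PropositionalEquality
  open import Relation.Binary.Definitions using (tri<; tri≈; tri>)
  open import Data.Nat.Induction using (<-rec)

  𝟙 : ∀ {a} {A : Set a} → Dec A → ℕ
  𝟙 (yes _) = 1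
  𝟙 (no _)  = 0

  𝟙-yes : ∀ {a} {A : Set a} → A → (d : Dec A) → 𝟙 d ≡ 1
  𝟙-yes a (yes _) = refl
  𝟙-yes a (no ¬a) = ⊥-elim (¬a a)

  𝟙-no : ∀ {a} {A : Set a} → ¬ A → (d : Dec A) → 𝟙 d ≡ 0
  𝟙-no ¬a (yes a) = ⊥-elim (¬a a)
  𝟙-no ¬a (no _)  = refl

  𝟙-mono : ∀ {a b} {A : Set a} {B : Set b} → (A → B) → (d : Dec A) (d' : Dec B) → 𝟙 d ≤ 𝟙 d'
  𝟙-mono f (yes a) (yes _) = ℕP.≤-refl
  𝟙-mono f (yes a) (no ¬b) = ⊥-elim (¬b (f a))
  𝟙-mono f (no _)  d'      = z≤n

  𝟙-cong : ∀ {a b} {A : Set a} {B : Set b} → (A → B) → (B → A) → (d : Dec A) (d' : Dec B) → 𝟙 d ≡ 𝟙 d'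
  𝟙-cong f g d d' = ℕP.≤-antisym (𝟙-mono f d d') (𝟙-mono g d' d)

  ∑-mono : ∀ {n} {f g : Fin n → ℕ} → (∀ x → f x ≤ g x) → ∑[ x < n ] f x ≤ ∑[ x < n ] g x
  ∑-mono {zero}  f≤g = z≤n
  ∑-mono {suc n} f≤g = ℕP.+-mono-≤ (f≤g Fin.zero) (∑-mono (λ x → f≤g (Fin.suc x)))

  term≤∑ : ∀ {n} (f : Fin n → ℕ) (i : Fin n) → f i ≤ ∑[ x < n ] f x
  term≤∑ f Fin.zero    = ℕP.m≤m+n _ _
  term≤∑ f (Fin.suc i) = ℕP.≤-trans (term≤∑ (λ x → f (Fin.suc x)) i) (ℕP.m≤n+m _ _)

  ∑-const-1 : ∀ n → ∑[ x < n ] 1 ≡ n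
  ∑-const-1 zero    = refl
  ∑-const-1 (suc n) = cong suc (∑-const-1 n)

  ∑-∈ : ∀ {n} (e : Subset n) → ∑[ x < n ] 𝟙 (x ∈? e) ≡ ∣ e ∣
  ∑-∈ {zero}  Vec.[] = refl
  ∑-∈ {suc n} (true  Vec.∷ e) =
    cong suc (trans (sum-cong-≗ {n} (λ x → 𝟙-cong drop-there Vec.there (Fin.suc x ∈? _) (x ∈? e))) (∑-∈ e))
  ∑-∈ {suc n} (false Vec.∷ e) =
    trans (sum-cong-≗ {n} (λ x → 𝟙-cong drop-there Vec.there (Fin.suc x ∈? _) (x ∈? e))) (∑-∈ e)

  ∑-≡ : ∀ {n} (y : Fin n) → ∑[ x < n ] 𝟙 (y Fin.≟ x) ≡ 1
  ∑-≡ {suc n} Fin.zero =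
    cong suc (trans (sum-cong-≗ {n} (λ x → 𝟙-no (λ ()) (Fin.zero Fin.≟ Fin.suc x))) (sum-replicate-zero n))
  ∑-≡ {suc n} (Fin.suc y) =
    cong₂ _+_ (𝟙-no (λ ()) (Fin.suc y Fin.≟ Fin.zero))
      (trans (sum-cong-≗ {n} (λ x → 𝟙-cong FinP.suc-injective (cong Fin.suc) (Fin.suc y Fin.≟ Fin.suc x) (y Fin.≟ x)))
        (∑-≡ y))

  count-split : ∀ {n} {P Q : Fin n → Set} (P? : Decidable P) (Q? : Decidable Q) → (∀ x → Q x → P x) →
    ∑[ x < n ] 𝟙 (P? x) ≡ ∑[ x < n ] 𝟙 (P? x ×-dec ¬? (Q? x)) + ∑[ x < n ] 𝟙 (Q? x)
  count-split {n} P? Q? Q⊆P =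
    trans (sum-cong-≗ {n} pointwise) (∑-distrib-+ (λ x → 𝟙 (P? x ×-dec ¬? (Q? x))) (λ x → 𝟙 (Q? x)))
    where
    pointwise : ∀ x → 𝟙 (P? x) ≡ 𝟙 (P? x ×-dec ¬? (Q? x)) + 𝟙 (Q? x)
    pointwise x with P? x | Q? x
    ... | yes _ | yes _  = refl
    ... | yes _ | no _   = refl
    ... | no ¬p | yes q  = ⊥-elim (¬p (Q⊆P x q))
    ... | no _  | no _   = refl

  witness : ∀ {n p} {P : Pred (Fin n) p} (P? : Decidable P) → 1 ≤ ∑[ x < n ] 𝟙 (P? x) → ∃ P
  witness {suc n} P? h with P? Fin.zero
  ... | yes p = Fin.zero , p
  ... | no _  = let (x , px) = witness (λ x → P? (Fin.suc x)) h in Fin.suc x , px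

  two-witnesses : ∀ {n p} {P : Pred (Fin n) p} (P? : Decidable P) → 2 ≤ ∑[ x < n ] 𝟙 (P? x) →
                  ∃₂ λ x y → x ≢ y × P x × P y
  two-witnesses {suc n} P? h with P? Fin.zero
  ... | yes p = let (y , py) = witness (λ x → P? (Fin.suc x)) (ℕP.≤-pred h) in
                Fin.zero , Fin.suc y , (λ ()) , p , py
  ... | no _  = let (x , y , x≢y , px , py) = two-witnesses (λ x → P? (Fin.suc x)) h in
                Fin.suc x , Fin.suc y , (λ eq → x≢y (FinP.suc-injective eq)) , px , py

  module _ {A : Set} where

    remove : ∀ {x : A} (xs : List A) → x ∈ₗ xs → List A
    remove (_ ∷ xs) (here _)  = xs
    remove (y ∷ xs) (there p) = y ∷ remove xs p

    length-remove : ∀ {x : A} (xs : List A) (p : x ∈ₗ xs) → length xs ≡ suc (length (remove xs p))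
    length-remove (_ ∷ xs) (here _)  = refl
    length-remove (y ∷ xs) (there p) = cong suc (length-remove xs p)

    remove-⊆ : ∀ {x y : A} (xs : List A) (p : x ∈ₗ xs) → y ∈ₗ remove xs p → y ∈ₗ xs
    remove-⊆ (_ ∷ xs) (here _)  q         = there q
    remove-⊆ (z ∷ xs) (there p) (here eq) = here eq
    remove-⊆ (z ∷ xs) (there p) (there q) = there (remove-⊆ xs p q)

    remove-keeps : ∀ {x y : A} (xs : List A) (p : x ∈ₗ xs) → y ∈ₗ xs → y ≢ x → y ∈ₗ remove xs p
    remove-keeps (_ ∷ xs) (here refl) (here refl) y≢x = ⊥-elim (y≢x refl)
    remove-keeps (_ ∷ xs) (here refl) (there q)   y≢x = q
    remove-keeps (z ∷ xs) (there p)   (here eq)   y≢x = here eq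
    remove-keeps (z ∷ xs) (there p)   (there q)   y≢x = there (remove-keeps xs p q y≢x)

    remove-unique : ∀ {x : A} (xs : List A) (p : x ∈ₗ xs) → Unique xs → Unique (remove xs p)
    remove-unique (_ ∷ xs) (here _)  (_ ∷ u)     = u
    remove-unique (z ∷ xs) (there p) (z≢ ∷ u) =
      All.tabulate (λ q → All.lookup z≢ (remove-⊆ xs p q)) ∷ remove-unique xs p u

    remove-≢ : ∀ {x y : A} (xs : List A) (p : x ∈ₗ xs) → Unique xs → y ∈ₗ remove xs p → y ≢ x
    remove-≢ (_ ∷ xs) (here refl) (x≢ ∷ u) q         refl = All.lookup x≢ q refl
    remove-≢ (z ∷ xs) (there p)   (z≢ ∷ u) (here refl) refl = All.lookup z≢ p refl
    remove-≢ (z ∷ xs) (there p)   (z≢ ∷ u) (there q)   = remove-≢ xs p u q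

    same-position : ∀ {x y : A} {xs : List A} (p : x ∈ₗ xs) (q : y ∈ₗ xs) → Any.index p ≡ Any.index q → x ≡ y
    same-position {xs = xs} p q same =
      trans (AnyP.lookup-index p) (trans (cong (lookup xs) same) (sym (AnyP.lookup-index q)))

  degree : ∀ {n} → Fin n → List (Subset n) → ℕ
  degree x []      = 0
  degree x (e ∷ F) = 𝟙 (x ∈? e) + degree x F

  degree≤candidates : ∀ {n} (x : Fin n) (F C : List (Subset n)) → Unique F →
    (∀ e → e ∈ₗ F → x ∈ e → e ∈ₗ C) → degree x F ≤ length C
  degree≤candidates x []      C u       cand = z≤n
  degree≤candidates x (e ∷ F) C (e≢ ∷ u) cand with x ∈? e
  ... | no _   = degree≤candidates x F C u (λ g g∈ x∈g → cand g (there g∈) x∈g)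
  ... | yes x∈e = subst (suc (degree x F) ≤_) (sym (length-remove C e∈C))
      (s≤s (degree≤candidates x F (remove C e∈C) u
        (λ g g∈ x∈g → remove-keeps C e∈C (cand g (there g∈) x∈g) (λ g≡e → All.lookup e≢ g∈ (sym g≡e)))))
    where
    e∈C : e ∈ₗ C
    e∈C = cand e (here refl) x∈e

  degree-outside : ∀ {n} (x : Fin n) (W : Subset n) (F : List (Subset n)) →
    All (λ e → (y : Fin n) → y ∈ e → y ∈ W) F → x ∉ W → degree x F ≡ 0
  degree-outside x W []      []           x∉W = refl
  degree-outside x W (e ∷ F) (e⊆W ∷ F⊆W) x∉W =
    cong₂ _+_ (𝟙-no (λ x∈e → x∉W (e⊆W x x∈e)) (x ∈? e)) (degree-outside x W F F⊆W x∉W)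

  handshake : ∀ {n} (k : ℕ) (F : List (Subset n)) → All (λ e → ∣ e ∣ ≡ k) F →
    length F * k ≡ ∑[ x < n ] degree x F
  handshake {n} k []      []          = sym (sum-replicate-zero n)
  handshake {n} k (e ∷ F) (∣e∣ ∷ unif) = begin
    k + length F * k                                       ≡⟨ cong₂ _+_ (sym ∣e∣) (handshake k F unif) ⟩
    ∣ e ∣ + ∑[ x < n ] degree x F                          ≡⟨ cong (_+ _) (sym (∑-∈ e)) ⟩
    ∑[ x < n ] 𝟙 (x ∈? e) + ∑[ x < n ] degree x F          ≡⟨ sym (∑-distrib-+ (λ x → 𝟙 (x ∈? e)) (λ x → degree x F)) ⟩
    ∑[ x < n ] degree x (e ∷ F)                            ∎
    where open ≡-Reasoning

  -- a cycle of length ℓ in the edge list F: the data of a Berge cycle, with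
  -- the edges given as members of F rather than as positions in it
  Cycle : ∀ {n} → List (Subset n) → ℕ → Set
  Cycle {n} F ℓ =
    2 ≤ ℓ × Σ ℕ λ m → ℓ ≡ suc m ×
    Σ (Fin (suc m) → Subset n) λ e → Injective _≡_ _≡_ e × ((i : Fin (suc m)) → e i ∈ₗ F) ×
    Σ (Fin (suc m) → Fin n) λ v → Injective _≡_ _≡_ v ×
    ((i : Fin (suc m)) → (v i ∈ e i) × (v i ∈ e (next i)))

  cycle-mono : ∀ {n} {F F' : List (Subset n)} {ℓ} → (∀ {e} → e ∈ₗ F → e ∈ₗ F') → Cycle F ℓ → Cycle F' ℓ
  cycle-mono F⊆F' (2≤ℓ , m , ℓ≡ , e , e-inj , e∈F , v , v-inj , v∈e) =
    2≤ℓ , m , ℓ≡ , e , e-inj , (λ i → F⊆F' (e∈F i)) , v , v-inj , v∈e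

  cycle⇒bergeCycle : ∀ {k n} (H : Hypergraph k n) {ℓ} → Cycle (edges H) ℓ → BergeCycle H ℓ
  cycle⇒bergeCycle H (2≤ℓ , m , ℓ≡ , e , e-inj , e∈F , v , v-inj , v∈e) =
    2≤ℓ , m , ℓ≡ , (λ i → Any.index (e∈F i)) ,
    (λ {i} {j} same → e-inj (same-position (e∈F i) (e∈F j) same)) ,
    v , v-inj ,
    λ i → subst (v i ∈_) (position i) (proj₁ (v∈e i)) , subst (v i ∈_) (position (next i)) (proj₂ (v∈e i))
    where
    position : ∀ i → e i ≡ lookup (edges H) (Any.index (e∈F i))
    position i = AnyP.lookup-index (e∈F i)

  toℕ-next : ∀ {m} (t : Fin (suc m)) → toℕ t < m → toℕ (next t) ≡ suc (toℕ t)
  toℕ-next {m} t t<m with suc (toℕ t) ℕ.<? suc m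
  ... | yes t+1≤m = FinP.toℕ-fromℕ< t+1≤m
  ... | no  t+1≰m = ⊥-elim (t+1≰m (s≤s t<m))

  next-last : ∀ {m} (t : Fin (suc m)) → toℕ t ≡ m → next t ≡ Fin.zero
  next-last {m} t t≡m with suc (toℕ t) ℕ.<? suc m
  ... | yes (s≤s t<m) = ⊥-elim (ℕP.<-irrefl t≡m t<m)
  ... | no  _         = refl

  toℕ≤last : ∀ {m} (t : Fin (suc m)) → toℕ t ≤ m
  toℕ≤last t = ℕP.≤-pred (FinP.toℕ<n t)

  injective-prefix : ∀ {m} {B : Set} (g : ℕ → B) → (∀ a b → a < b → b ≤ m → g a ≢ g b) →
    Injective _≡_ _≡_ (λ (t : Fin (suc m)) → g (toℕ t))
  injective-prefix g distinct {t} {t'} same with ℕP.<-cmp (toℕ t) (toℕ t')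
  ... | tri< t<t' _ _ = ⊥-elim (distinct _ _ t<t' (toℕ≤last t') same)
  ... | tri≈ _ t≡t' _ = FinP.toℕ-injective t≡t'
  ... | tri> _ _ t>t' = ⊥-elim (distinct _ _ t>t' (toℕ≤last t) (sym same))

  -- A trail in F: edges e t ∈ F and vertices y (t+1) ∈ e t ∩ e (t+1).
  module Trail {n} (F : List (Subset n)) (e : ℕ → Subset n) (y : ℕ → Fin n)
    (e∈F : ∀ t → e t ∈ₗ F) (y∈e : ∀ t → y (suc t) ∈ e t) (y∈e′ : ∀ t → y (suc t) ∈ e (suc t)) where

    close-cycle : (i m : ℕ) → 1 ≤ m →
      (∀ a b → a < b → b ≤ m → e (i + a) ≢ e (i + b)) →
      (∀ a b → a < b → b ≤ m → y (suc (i + a)) ≢ y (suc (i + b))) →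
      y (suc (i + m)) ∈ e i → Cycle F (suc m)
    close-cycle i m 1≤m e-distinct y-distinct closing =
      s≤s 1≤m , m , refl ,
      (λ t → e (i + toℕ t)) , injective-prefix (λ a → e (i + a)) e-distinct , (λ t → e∈F (i + toℕ t)) ,
      (λ t → y (suc (i + toℕ t))) , injective-prefix (λ a → y (suc (i + a))) y-distinct ,
      λ t → y∈e (i + toℕ t) , y∈next t
      where
      y∈next : ∀ t → y (suc (i + toℕ t)) ∈ e (i + toℕ (next t))
      y∈next t with ℕP.m≤n⇒m<n∨m≡n (toℕ≤last t)
      ... | inj₁ t<m rewrite toℕ-next t t<m | ℕP.+-suc i (toℕ t) = y∈e′ (i + toℕ t)
      ... | inj₂ t≡m rewrite next-last t t≡m | ℕP.+-identityʳ i | t≡m = closing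

  least : ∀ {p} {P : Pred ℕ p} → Decidable P → ∀ b → P b →
          ∃ λ j → j ≤ b × P j × (∀ i → i < j → ¬ P i)
  least {P = P} P? = <-rec _ search
    where
    search : ∀ b → (∀ {i} → i < b → P i → ∃ λ j → j ≤ i × P j × (∀ i' → i' < j → ¬ P i')) →
             P b → ∃ λ j → j ≤ b × P j × (∀ i → i < j → ¬ P i)
    search b below pb with ℕP.anyUpTo? P? b
    ... | no none = b , ℕP.≤-refl , pb , λ i i<b pi → none (i , i<b , pi)
    ... | yes (i , i<b , pi) =
      let (j , j≤i , pj , minimal) = below i<b pi in j , ℕP.≤-trans j≤i (ℕP.<⇒≤ i<b) , pj , minimal

  -- The walk argument: an edge list without leaves contains a short cycle.

  _≟ₛ_ : ∀ {n} (e g : Subset n) → Dec (e ≡ g)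
  _≟ₛ_ = VecP.≡-dec Bool._≟_

  Shared : ∀ {n} → List (Subset n) → Subset n → Fin n → Set
  Shared F e u = u ∈ e × Any (λ g → g ≢ e × u ∈ g) F

  shared? : ∀ {n} (F : List (Subset n)) (e : Subset n) (u : Fin n) → Dec (Shared F e u)
  shared? F e u = (u ∈? e) ×-dec any? (λ g → ¬? (g ≟ₛ e) ×-dec (u ∈? g)) F

  Branching : ∀ {n} → List (Subset n) → Subset n → Set
  Branching F e = ∃₂ λ u v → u ≢ v × Shared F e u × Shared F e v

  -- If no edge of F is a leaf, walk from edge to edge, always leaving
  -- through a shared vertex other than the one used to enter.  Among the
  -- first |F| + 1 steps some edge repeats; the first repetition (of an
  -- edge or of an entry vertex) closes a cycle of length at most |F|.
  module Walk {n} (F : List (Subset n)) (branching : ∀ e → e ∈ₗ F → Branching F e)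
              (e₀ : Subset n) (e₀∈F : e₀ ∈ₗ F) where

    -- the current edge and the vertex through which it was entered
    State : Set
    State = Σ (Subset n) (_∈ₗ F) × Fin n

    edgeOf : State → Subset n
    edgeOf ((e , _) , _) = e

    entry : State → Fin n
    entry (_ , y) = y

    Move : State → State → Set
    Move s s' = entry s' ∈ edgeOf s × entry s' ∈ edgeOf s' × entry s' ≢ entry s × edgeOf s' ≢ edgeOf s

    leave-through : ∀ {e} (e∈F : e ∈ₗ F) y u → Shared F e u → u ≢ y → Σ State (Move ((e , e∈F) , y))
    leave-through e∈F y u (u∈e , elsewhere) u≢y with find elsewhere
    ... | g , g∈F , g≢e , u∈g = ((g , g∈F) , u) , u∈e , u∈g , u≢y , g≢e

    step : (s : State) → Σ State (Move s)
    step ((e , e∈F) , y) with branching e e∈F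
    ... | u , v , u≢v , shared-u , shared-v with u Fin.≟ y
    ...   | yes refl = leave-through e∈F y v shared-v (λ v≡u → u≢v (sym v≡u))
    ...   | no  u≢y  = leave-through e∈F y u shared-u u≢y

    walk : ℕ → State
    walk zero    = (e₀ , e₀∈F) , proj₁ (branching e₀ e₀∈F)
    walk (suc t) = proj₁ (step (walk t))

    e : ℕ → Subset n
    e t = edgeOf (walk t)

    y : ℕ → Fin n
    y t = entry (walk t)

    move : ∀ t → Move (walk t) (walk (suc t))
    move t = proj₂ (step (walk t))

    e∈F : ∀ t → e t ∈ₗ F
    e∈F t = proj₂ (proj₁ (walk t))

    open Trail F e y e∈F (λ t → proj₁ (move t)) (λ t → proj₁ (proj₂ (move t)))

    VertexRevisit : ℕ → ℕ → Set
    VertexRevisit j i = 1 ≤ i × y i ≡ y j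

    Revisit : ℕ → ℕ → Set
    Revisit j i = (e i ≡ e j) ⊎ VertexRevisit j i

    Repeat : ℕ → Set
    Repeat j = ∃ λ i → i < j × Revisit j i

    VertexRepeat : ℕ → Set
    VertexRepeat j = ∃ λ i → i < j × VertexRevisit j i

    vertexRevisit? : ∀ j i → Dec (VertexRevisit j i)
    vertexRevisit? j i = (1 ℕ.≤? i) ×-dec (y i Fin.≟ y j)

    repeat? : Decidable Repeat
    repeat? j = ℕP.anyUpTo? (λ i → (e i ≟ₛ e j) ⊎-dec vertexRevisit? j i) j

    early-repeat : ∃ λ j → j ≤ length F × Repeat j
    early-repeat with FinP.pigeonhole (ℕP.≤-refl {suc (length F)}) (λ t → Any.index (e∈F (toℕ t)))
    ... | a , b , a<b , same-index =
      toℕ b , toℕ≤last b , toℕ a , a<b ,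
      inj₁ (same-position (e∈F (toℕ a)) (e∈F (toℕ b)) same-index)

    module FirstRepeat (i d : ℕ) (first : ∀ x → x < suc (i + d) → ¬ Repeat x) where

      edges-distinct : ∀ a b → a < b → b ≤ d → e (i + a) ≢ e (i + b)
      edges-distinct a b a<b b≤d same =
        first (i + b) (s≤s (ℕP.+-monoʳ-≤ i b≤d)) (i + a , ℕP.+-monoʳ-< i a<b , inj₁ same)

      vertices-distinct : ∀ a b → a < b → b < d → y (suc (i + a)) ≢ y (suc (i + b))
      vertices-distinct a b a<b b<d same =
        first (suc (i + b)) (s≤s (ℕP.+-monoʳ-< i b<d))
          (suc (i + a) , s≤s (ℕP.+-monoʳ-< i a<b) , inj₂ (s≤s z≤n , same))

    open FirstRepeat

    -- first repetition is the vertex y i = y (i+d+1): cycle e i, …, e (i+d)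
    -- (d ≥ 1 as consecutive entry vertices differ)
    vertex-repeat-cycle : ∀ i d → (∀ x → x < suc (i + d) → ¬ Repeat x) →
      VertexRevisit (suc (i + d)) i → Cycle F (suc d)
    vertex-repeat-cycle i zero first (_ , same) =
      ⊥-elim (proj₁ (proj₂ (proj₂ (move i))) (trans (cong (λ t → y (suc t)) (sym (ℕP.+-identityʳ i))) (sym same)))
    vertex-repeat-cycle (suc i') (suc d') first (1≤i , same) =
      close-cycle i (suc d') (s≤s z≤n) (edges-distinct i (suc d') first) distinct
        (subst (_∈ e i) same (proj₁ (proj₂ (move i'))))
      where
      i : ℕ
      i = suc i'
      distinct : ∀ a b → a < b → b ≤ suc d' → y (suc (i + a)) ≢ y (suc (i + b))
      distinct a b a<b b≤d with ℕP.m≤n⇒m<n∨m≡n b≤d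
      ... | inj₁ b<d  = vertices-distinct i (suc d') first a b a<b b<d
      ... | inj₂ refl = λ same' → first (suc (i + a)) (s≤s (ℕP.+-monoʳ-< i a<b))
              (i , s≤s (ℕP.m≤m+n i a) , inj₂ (1≤i , trans same (sym same')))

    edge-repeat-cycle : ∀ i d → (∀ x → x < suc (i + d) → ¬ Repeat x) → ¬ VertexRepeat (suc (i + d)) →
      e i ≡ e (suc (i + d)) → Cycle F (suc d)
    edge-repeat-cycle i zero first no-vertex-repeat same =
      ⊥-elim (proj₂ (proj₂ (proj₂ (move i))) (trans (cong (λ t → e (suc t)) (sym (ℕP.+-identityʳ i))) (sym same)))
    edge-repeat-cycle i (suc d') first no-vertex-repeat same =
      close-cycle i (suc d') (s≤s z≤n) (edges-distinct i (suc d') first) distinct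
        (subst (y (suc (i + suc d')) ∈_) (sym same) (proj₁ (proj₂ (move (i + suc d')))))
      where
      distinct : ∀ a b → a < b → b ≤ suc d' → y (suc (i + a)) ≢ y (suc (i + b))
      distinct a b a<b b≤d with ℕP.m≤n⇒m<n∨m≡n b≤d
      ... | inj₁ b<d  = vertices-distinct i (suc d') first a b a<b b<d
      ... | inj₂ refl = λ same' → no-vertex-repeat (suc (i + a) , s≤s (ℕP.+-monoʳ-< i a<b) , s≤s z≤n , same')

    first-repeat-cycle : ∀ j → Repeat j → (∀ x → x < j → ¬ Repeat x) → ∃ λ ℓ → ℓ ≤ j × Cycle F ℓ
    first-repeat-cycle j _ first with ℕP.anyUpTo? (vertexRevisit? j) j
    first-repeat-cycle j _ first | yes (i , i<j , revisit) with ℕP.m≤n⇒∃[o]m+o≡n i<j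
    ... | d , refl = suc d , s≤s (ℕP.m≤n+m d i) , vertex-repeat-cycle i d first revisit
    first-repeat-cycle j (i , i<j , inj₂ revisit) first | no none = ⊥-elim (none (i , i<j , revisit))
    first-repeat-cycle j (i , i<j , inj₁ same)    first | no none with ℕP.m≤n⇒∃[o]m+o≡n i<j
    ... | d , refl = suc d , s≤s (ℕP.m≤n+m d i) , edge-repeat-cycle i d first none same

    short-cycle : ∃ λ ℓ → ℓ ≤ length F × Cycle F ℓ
    short-cycle with early-repeat
    ... | j₀ , j₀≤|F| , repeat-j₀ with least repeat? j₀ repeat-j₀
    ... | j , j≤j₀ , repeat-j , first with first-repeat-cycle j repeat-j first
    ... | ℓ , ℓ≤j , cycle = ℓ , ℕP.≤-trans ℓ≤j (ℕP.≤-trans j≤j₀ j₀≤|F|) , cycle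

  -- The forest count: (k - 1)·|F| + 1 ≤ |W| for an acyclic k-uniform F on W.

  -- F has no cycle of length at most |F|; as a cycle uses distinct edges of
  -- F, this says that F has no cycle at all
  Acyclic : ∀ {n} → List (Subset n) → Set
  Acyclic F = ∀ ℓ → ℓ ≤ length F → ¬ Cycle F ℓ

  -- the number of shared vertices of e; e is a leaf of F when it is at most one
  sharedCount : ∀ {n} → List (Subset n) → Subset n → ℕ
  sharedCount {n} F e = ∑[ x < n ] 𝟙 (shared? F e x)

  branching-or-leaf : ∀ {n} (F G : List (Subset n)) →
    (∀ e → e ∈ₗ G → Branching F e) ⊎ (∃ λ e → e ∈ₗ G × sharedCount F e ≤ 1)
  branching-or-leaf F []      = inj₁ (λ e ())
  branching-or-leaf F (g ∷ G) with 2 ℕ.≤? sharedCount F g | branching-or-leaf F G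
  ... | no  few  | _                        = inj₂ (g , here refl , ℕP.≤-pred (ℕP.≰⇒> few))
  ... | yes _    | inj₂ (e , e∈G , leaf)    = inj₂ (e , there e∈G , leaf)
  ... | yes many | inj₁ branching-G         = inj₁ λ where
    e (here refl) → two-witnesses (shared? F g) many
    e (there e∈G) → branching-G e e∈G

  acyclic-leaf : ∀ {n} (F : List (Subset n)) → Acyclic F → 1 ≤ length F →
    ∃ λ e → e ∈ₗ F × sharedCount F e ≤ 1
  acyclic-leaf (e₀ ∷ F₀) acyclic _ with branching-or-leaf (e₀ ∷ F₀) (e₀ ∷ F₀)
  ... | inj₂ leaf      = leaf
  ... | inj₁ branching =
    let (ℓ , ℓ≤|F| , cycle) = Walk.short-cycle (e₀ ∷ F₀) branching e₀ (here refl) in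
    ⊥-elim (acyclic ℓ ℓ≤|F| cycle)

  acyclic-remove : ∀ {n} {e} (F : List (Subset n)) (e∈F : e ∈ₗ F) → Acyclic F → Acyclic (remove F e∈F)
  acyclic-remove F e∈F acyclic ℓ ℓ≤ cycle =
    acyclic ℓ (ℕP.≤-trans ℓ≤ (ℕP.≤-trans (ℕP.n≤1+n _) (ℕP.≤-reflexive (sym (length-remove F e∈F)))))
      (cycle-mono (remove-⊆ F e∈F) cycle)

  -- Removing a leaf e of an acyclic k-uniform F on W: e has at least k - 1
  -- private vertices (in no other edge), and the remaining edges live on W
  -- minus those private vertices.
  module LeafRemoval {n} (k' : ℕ) (F : List (Subset n)) (W : Fin n → Set) (W? : Decidable W)
    (unique : Unique F) (uniform : All (λ e → ∣ e ∣ ≡ suc k') F) (inside : All (λ e → ∀ x → x ∈ e → W x) F)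
    (acyclic : Acyclic F) (nonempty : 1 ≤ length F) where

    leaf : ∃ λ e → e ∈ₗ F × sharedCount F e ≤ 1
    leaf = acyclic-leaf F acyclic nonempty

    e : Subset n
    e = proj₁ leaf

    e∈F : e ∈ₗ F
    e∈F = proj₁ (proj₂ leaf)

    Private : Fin n → Set
    Private x = x ∈ e × ¬ Shared F e x

    private? : Decidable Private
    private? x = (x ∈? e) ×-dec ¬? (shared? F e x)

    |e| : ∑[ x < n ] 𝟙 (x ∈? e) ≡ suc k'
    |e| = trans (∑-∈ e) (All.lookup uniform e∈F)

    e⊆W : ∀ x → x ∈ e → W x
    e⊆W = All.lookup inside e∈F

    many-private : k' ≤ ∑[ x < n ] 𝟙 (private? x)
    many-private = ℕP.+-cancelˡ-≤ 1 k' _ (begin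
      suc k'                                          ≡⟨ sym |e| ⟩
      ∑[ x < n ] 𝟙 (x ∈? e)                           ≡⟨ count-split (_∈? e) (shared? F e) (λ x → proj₁) ⟩
      ∑[ x < n ] 𝟙 (private? x) + sharedCount F e     ≤⟨ ℕP.+-monoʳ-≤ _ (proj₂ (proj₂ leaf)) ⟩
      ∑[ x < n ] 𝟙 (private? x) + 1                   ≡⟨ ℕP.+-comm _ 1 ⟩
      1 + ∑[ x < n ] 𝟙 (private? x)                   ∎)
      where open ℕP.≤-Reasoning

    W′ : Fin n → Set
    W′ x = W x × ¬ Private x

    W′? : Decidable W′
    W′? x = W? x ×-dec ¬? (private? x)

    |W| : ∑[ x < n ] 𝟙 (W? x) ≡ ∑[ x < n ] 𝟙 (W′? x) + ∑[ x < n ] 𝟙 (private? x)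
    |W| = count-split W? private? (λ x (x∈e , _) → e⊆W x x∈e)

    F′ : List (Subset n)
    F′ = remove F e∈F

    |F|≡1+|F′| : length F ≡ suc (length F′)
    |F|≡1+|F′| = length-remove F e∈F

    unique′ : Unique F′
    unique′ = remove-unique F e∈F unique

    uniform′ : All (λ g → ∣ g ∣ ≡ suc k') F′
    uniform′ = All.tabulate (λ g∈F′ → All.lookup uniform (remove-⊆ F e∈F g∈F′))

    -- a vertex of another edge g is shared, hence not private
    inside′ : All (λ g → ∀ x → x ∈ g → W′ x) F′
    inside′ = All.tabulate λ {g} g∈F′ x x∈g →
      All.lookup inside (remove-⊆ F e∈F g∈F′) x x∈g ,
      λ (x∈e , unshared) → unshared (x∈e , lose (remove-⊆ F e∈F g∈F′) (remove-≢ F e∈F unique g∈F′ , x∈g))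

    acyclic′ : Acyclic F′
    acyclic′ = acyclic-remove F e∈F acyclic

  forest-bound : ∀ {n} (k' f : ℕ) (F : List (Subset n)) (W : Fin n → Set) (W? : Decidable W) →
    length F ≡ suc f → Unique F → All (λ e → ∣ e ∣ ≡ suc k') F → All (λ e → ∀ x → x ∈ e → W x) F →
    Acyclic F → k' * suc f + 1 ≤ ∑[ x < n ] 𝟙 (W? x)
  forest-bound {n} k' zero F W W? |F| unique uniform inside acyclic = begin
    k' * 1 + 1                 ≡⟨ cong (_+ 1) (ℕP.*-identityʳ k') ⟩
    k' + 1                     ≡⟨ ℕP.+-comm k' 1 ⟩
    suc k'                     ≡⟨ sym |e| ⟩
    ∑[ x < n ] 𝟙 (x ∈? e)      ≤⟨ ∑-mono (λ x → 𝟙-mono (e⊆W x) (x ∈? e) (W? x)) ⟩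
    ∑[ x < n ] 𝟙 (W? x)        ∎
    where
    open ℕP.≤-Reasoning
    open LeafRemoval k' F W W? unique uniform inside acyclic (subst (1 ≤_) (sym |F|) (s≤s z≤n))
  forest-bound {n} k' (suc f) F W W? |F| unique uniform inside acyclic = begin
    k' * suc (suc f) + 1                                          ≡⟨ cong (_+ 1) (ℕP.*-suc k' (suc f)) ⟩
    (k' + k' * suc f) + 1                                         ≡⟨ ℕP.+-assoc k' _ 1 ⟩
    k' + (k' * suc f + 1)                                         ≤⟨ ℕP.+-mono-≤ many-private bound′ ⟩
    ∑[ x < n ] 𝟙 (private? x) + ∑[ x < n ] 𝟙 (W′? x)              ≡⟨ ℕP.+-comm (∑[ x < n ] 𝟙 (private? x)) _ ⟩
    ∑[ x < n ] 𝟙 (W′? x) + ∑[ x < n ] 𝟙 (private? x)              ≡⟨ sym |W| ⟩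
    ∑[ x < n ] 𝟙 (W? x)                                           ∎
    where
    open ℕP.≤-Reasoning
    open LeafRemoval k' F W W? unique uniform inside acyclic (subst (1 ≤_) (sym |F|) (s≤s z≤n))
    bound′ : k' * suc f + 1 ≤ ∑[ x < n ] 𝟙 (W′? x)
    bound′ = forest-bound k' f F′ W′ W′? (ℕP.suc-injective (trans (sym |F|≡1+|F′|) |F|))
               unique′ uniform′ inside′ acyclic′

  -- The degree count for contracted absorbers: k·|F'| ≤ 2·|W'| + k² for
  -- every sub-hypergraph (W', F').

  matching-unique : ∀ {n} {M : List (Subset n)} {U : Fin n → Set} → MatchingCovering M U →
    ∀ {e e' x} → e ∈ₗ M → e' ∈ₗ M → x ∈ e → x ∈ e' → e ≡ e'
  matching-unique {M = M} (disjoint , _ , _) {e} {e'} {x} e∈M e'∈M x∈e x∈e'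
    with Any.index e∈M Fin.≟ Any.index e'∈M
  ... | yes same = same-position e∈M e'∈M same
  ... | no  different = ⊥-elim (disjoint _ _ different x
          (subst (x ∈_) (AnyP.lookup-index e∈M) x∈e) (subst (x ∈_) (AnyP.lookup-index e'∈M) x∈e'))

  subgraph-uniform : ∀ {k n} {H : Hypergraph k n} (H' : SubHypergraph H) → All (λ e → ∣ e ∣ ≡ k) (F H')
  subgraph-uniform {H = H} H' = All.tabulate (λ e∈F → All.lookup (uniform H) (All.lookup (F-sub H') e∈F))

  module ContractedAbsorber {k n : ℕ} (H : Hypergraph k n) (absorber : IsContractedAbsorber H) where

    r : Fin k → Fin n
    r = proj₁ absorber

    A : Fin (k ∸ 1) → Absorber k n r
    A = proj₁ (proj₂ (proj₂ absorber))

    meet-in-roots : (i j : Fin (k ∸ 1)) → i ≢ j → (x : Fin n) → x ∈ V (A i) → x ∈ V (A j) → IsRoot r x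
    meet-in-roots = proj₁ (proj₂ (proj₂ (proj₂ absorber)))

    covered : (x : Fin n) → ∃ λ i → x ∈ V (A i)
    covered = proj₁ (proj₂ (proj₂ (proj₂ (proj₂ absorber))))

    edge-of-absorber : (e : Subset n) → e ∈ₗ edges H → ∃ λ i → e ∈ₗ E (A i)
    edge-of-absorber e = proj₁ (proj₂ (proj₂ (proj₂ (proj₂ (proj₂ absorber)))) e)

    in-matchings : ∀ j {e} → e ∈ₗ E (A j) → e ∈ₗ M₁ (A j) ⊎ e ∈ₗ M₂ (A j)
    in-matchings j e∈E = ∈-++⁻ (M₁ (A j)) (∈-resp-↭ (split (A j)) e∈E)

    -- a non-root vertex lies only in the M₁- and M₂-edge through it of the
    -- unique absorber containing it
    nonroot-edges : ∀ x → ¬ IsRoot r x →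
      Σ (List (Subset n)) λ C → length C ≡ 2 × (∀ e → e ∈ₗ edges H → x ∈ e → e ∈ₗ C)
    nonroot-edges x nonroot with covered x
    ... | i , x∈Vᵢ with proj₂ (proj₂ (M₁-perf (A i))) x x∈Vᵢ | proj₂ (proj₂ (M₂-cover (A i))) x (x∈Vᵢ , nonroot)
    ... | a₁ , a₁∈M₁ , x∈a₁ | a₂ , a₂∈M₂ , x∈a₂ = a₁ ∷ a₂ ∷ [] , refl , candidates
      where
      candidates : ∀ e → e ∈ₗ edges H → x ∈ e → e ∈ₗ a₁ ∷ a₂ ∷ []
      candidates e e∈H x∈e with edge-of-absorber e e∈H
      ... | j , e∈Eⱼ with i Fin.≟ j
      ...   | no i≢j  = ⊥-elim (nonroot (meet-in-roots i j i≢j x x∈Vᵢ (All.lookup (E-in-V (A j)) e∈Eⱼ x x∈e)))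
      ...   | yes refl with in-matchings i e∈Eⱼ
      ...     | inj₁ e∈M₁ = here (matching-unique (M₁-perf (A i)) e∈M₁ a₁∈M₁ x∈e x∈a₁)
      ...     | inj₂ e∈M₂ = there (here (matching-unique (M₂-cover (A i)) e∈M₂ a₂∈M₂ x∈e x∈a₂))

    -- a root lies only in the M₁-edges through it, one in each of the k - 1 absorbers
    root-edges : ∀ x → IsRoot r x →
      Σ (List (Subset n)) λ C → length C ≡ k ∸ 1 × (∀ e → e ∈ₗ edges H → x ∈ e → e ∈ₗ C)
    root-edges x (i₀ , rᵢ₀≡x) = tabulate through , length-tabulate through , candidates
      where
      x∈V : ∀ j → x ∈ V (A j)
      x∈V j = subst (_∈ V (A j)) rᵢ₀≡x (roots-in (A j) i₀)
      through : Fin (k ∸ 1) → Subset n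
      through j = proj₁ (proj₂ (proj₂ (M₁-perf (A j))) x (x∈V j))
      candidates : ∀ e → e ∈ₗ edges H → x ∈ e → e ∈ₗ tabulate through
      candidates e e∈H x∈e with edge-of-absorber e e∈H
      ... | j , e∈Eⱼ with in-matchings j e∈Eⱼ
      ...   | inj₂ e∈M₂ = ⊥-elim (proj₂ (All.lookup (proj₁ (proj₂ (M₂-cover (A j)))) e∈M₂ x x∈e) (i₀ , rᵢ₀≡x))
      ...   | inj₁ e∈M₁ =
        let (_ , t∈M₁ , x∈t) = proj₂ (proj₂ (M₁-perf (A j))) x (x∈V j) in
        subst (_∈ₗ tabulate through) (sym (matching-unique (M₁-perf (A j)) e∈M₁ t∈M₁ x∈e x∈t)) (∈-tabulate⁺ j)

    degree-bound : (H' : SubHypergraph H) → ∀ x →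
      degree x (F H') ≤ 2 * 𝟙 (x ∈? W H') + k * ∑[ i < k ] 𝟙 (r i Fin.≟ x)
    degree-bound H' x with x ∈? W H'
    ... | no x∉W′ = ℕP.≤-trans (ℕP.≤-reflexive (degree-outside x (W H') (F H') (F-in-W H') x∉W′)) z≤n
    ... | yes _ with FinP.any? (λ i → r i Fin.≟ x)
    ...   | no nonroot = let (C , |C| , cand) = nonroot-edges x nonroot in begin
      degree x (F H')   ≤⟨ degree≤candidates x (F H') C (F-unique H') (λ e e∈F → cand e (All.lookup (F-sub H') e∈F)) ⟩
      length C          ≡⟨ |C| ⟩
      2                 ≤⟨ ℕP.m≤m+n 2 _ ⟩
      2 * 1 + k * ∑[ i < k ] 𝟙 (r i Fin.≟ x) ∎
      where open ℕP.≤-Reasoning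
    ...   | yes (i , rᵢ≡x) = let (C , |C| , cand) = root-edges x (i , rᵢ≡x) in begin
      degree x (F H')   ≤⟨ degree≤candidates x (F H') C (F-unique H') (λ e e∈F → cand e (All.lookup (F-sub H') e∈F)) ⟩
      length C          ≡⟨ |C| ⟩
      k ∸ 1             ≤⟨ ℕP.m∸n≤m k 1 ⟩
      k                 ≡⟨ sym (ℕP.*-identityʳ k) ⟩
      k * 1             ≡⟨ cong (k *_) (sym (𝟙-yes rᵢ≡x (r i Fin.≟ x))) ⟩
      k * 𝟙 (r i Fin.≟ x)                    ≤⟨ ℕP.*-monoʳ-≤ k (term≤∑ (λ i → 𝟙 (r i Fin.≟ x)) i) ⟩
      k * ∑[ i < k ] 𝟙 (r i Fin.≟ x)         ≤⟨ ℕP.m≤n+m _ (2 * 1) ⟩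
      2 * 1 + k * ∑[ i < k ] 𝟙 (r i Fin.≟ x) ∎
      where open ℕP.≤-Reasoning

    edge-count-bound : (H' : SubHypergraph H) → length (F H') * k ≤ 2 * ∣ W H' ∣ + k * k
    edge-count-bound H' = begin
      length (F H') * k
        ≡⟨ handshake k (F H') (subgraph-uniform H') ⟩
      ∑[ x < n ] degree x (F H')
        ≤⟨ ∑-mono (degree-bound H') ⟩
      ∑[ x < n ] (2 * 𝟙 (x ∈? W H') + k * ∑[ i < k ] 𝟙 (r i Fin.≟ x))
        ≡⟨ ∑-distrib-+ (λ x → 2 * 𝟙 (x ∈? W H')) _ ⟩
      ∑[ x < n ] (2 * 𝟙 (x ∈? W H')) + ∑[ x < n ] (k * ∑[ i < k ] 𝟙 (r i Fin.≟ x))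
        ≡⟨ sym (cong₂ _+_ (*-distribˡ-sum {n} 2 (λ x → 𝟙 (x ∈? W H'))) (*-distribˡ-sum {n} k _)) ⟩
      2 * ∑[ x < n ] 𝟙 (x ∈? W H') + k * ∑[ x < n ] (∑[ i < k ] 𝟙 (r i Fin.≟ x))
        ≡⟨ cong₂ (λ a b → 2 * a + k * b) (∑-∈ (W H')) (∑-comm (λ x i → 𝟙 (r i Fin.≟ x))) ⟩
      2 * ∣ W H' ∣ + k * ∑[ i < k ] (∑[ x < n ] 𝟙 (r i Fin.≟ x))
        ≡⟨ cong (λ b → 2 * ∣ W H' ∣ + k * b) (trans (sum-cong-≗ {k} (λ i → ∑-≡ (r i))) (∑-const-1 k)) ⟩
      2 * ∣ W H' ∣ + k * k ∎
      where open ℕP.≤-Reasoning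


-- Arithmetic of the two cases.  With f + 1 edges and k + d vertices
-- (d ≥ 1), the target (f + 1 - 1)/d ≤ 2/k + 1/D reads f·kD ≤ (2D + k)·d.

module Arithmetic where

  open import Data.Nat using (suc; _≤_; _+_; _*_)
  import Data.Nat.Properties as ℕP
  open import Data.Nat.Tactic.RingSolver using (solve-∀)
  open import Relation.Binary.PropositionalEquality using (_≡_; subst; subst₂)

  dense-bound : ∀ k D d f → suc k * D ≤ d → suc f * k ≤ 2 * (k + d) + k * k →
    f * (k * D) ≤ (2 * D + k) * d
  dense-bound k D d f large degree-count = begin
    f * (k * D)                  ≡⟨ regroup f k D ⟩
    (f * k) * D                  ≤⟨ ℕP.*-monoˡ-≤ D f*k≤ ⟩
    (2 * d + k * suc k) * D      ≡⟨ expand d k D ⟩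
    2 * D * d + k * (suc k * D)  ≤⟨ ℕP.+-monoʳ-≤ (2 * D * d) (ℕP.*-monoʳ-≤ k large) ⟩
    2 * D * d + k * d            ≡⟨ collect D k d ⟩
    (2 * D + k) * d              ∎
    where
    open ℕP.≤-Reasoning
    regroup : ∀ f k D → f * (k * D) ≡ (f * k) * D
    regroup = solve-∀
    expand : ∀ d k D → (2 * d + k * suc k) * D ≡ 2 * D * d + k * (suc k * D)
    expand = solve-∀
    collect : ∀ D k d → 2 * D * d + k * d ≡ (2 * D + k) * d
    collect = solve-∀
    shift-lhs : ∀ f k → suc f * k ≡ k + f * k
    shift-lhs = solve-∀
    shift-rhs : ∀ k d → 2 * (k + d) + k * k ≡ k + (2 * d + k * suc k)
    shift-rhs = solve-∀
    f*k≤ : f * k ≤ 2 * d + k * suc k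
    f*k≤ = ℕP.+-cancelˡ-≤ k _ _ (subst₂ _≤_ (shift-lhs f k) (shift-rhs k d) degree-count)

  -- sparse case: the forest count gives (f + 1 - 1)/d ≤ 1/(k - 1) ≤ 2/k
  sparse-bound : ∀ k' D d f → 1 ≤ k' → k' * suc f + 1 ≤ suc k' + d →
    f * (suc k' * D) ≤ (2 * D + suc k') * d
  sparse-bound k' D d f 1≤k' forest-count = begin
    f * (suc k' * D)      ≤⟨ ℕP.*-monoʳ-≤ f (ℕP.*-monoˡ-≤ D (ℕP.+-monoˡ-≤ k' 1≤k')) ⟩
    f * ((k' + k') * D)   ≡⟨ regroup f k' D ⟩
    2 * D * (k' * f)      ≤⟨ ℕP.*-monoʳ-≤ (2 * D) k'*f≤d ⟩
    2 * D * d             ≤⟨ ℕP.*-monoˡ-≤ d (ℕP.m≤m+n (2 * D) (suc k')) ⟩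
    (2 * D + suc k') * d  ∎
    where
    open ℕP.≤-Reasoning
    regroup : ∀ f k' D → f * ((k' + k') * D) ≡ 2 * D * (k' * f)
    regroup = solve-∀
    shift : ∀ k' f → k' * suc f + 1 ≡ suc k' + k' * f
    shift = solve-∀
    k'*f≤d : k' * f ≤ d
    k'*f≤d = ℕP.+-cancelˡ-≤ (suc k') _ _ (subst (_≤ suc k' + d) (shift k' f) forest-count)


-- From cross-multiplied integer inequalities to rational ones, through
-- unnormalised rationals (where addition and ≤ are literally the
-- cross-multiplication formulas).

module Rationals where

  open import Defs using (frac)
  open import Data.Nat as ℕ using (ℕ; suc)
  import Data.Nat.Properties as ℕP
  open import Data.Integer as ℤ using (ℤ; +_; +[1+_]; -[1+_])
  import Data.Integer.Properties as ℤP
  open import Data.Rational as ℚ using (ℚ; 0ℚ; mkℚ; toℚᵘ; ↧ₙ_)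
  import Data.Rational.Properties as ℚP
  open import Data.Rational.Unnormalised as ℚᵘ using (mkℚᵘ; *≤*)
  import Data.Rational.Unnormalised.Properties as ℚᵘP
  open import Relation.Binary.PropositionalEquality using (_≡_; sym; cong; cong₂; trans; subst; subst₂)

  frac≃ : (a : ℤ) (d : ℕ) → toℚᵘ (frac a (suc d)) ℚᵘ.≃ mkℚᵘ a d
  frac≃ a d = ℚP.toℚᵘ-fromℚᵘ (mkℚᵘ a d)

  frac≤2/k+1/D : (a : ℤ) (d k D : ℕ) →
    a ℤ.* + (suc k ℕ.* suc D) ℤ.≤ + ((2 ℕ.* suc D ℕ.+ suc k) ℕ.* suc d) →
    frac a (suc d) ℚ.≤ frac (+ 2) (suc k) ℚ.+ frac (+ 1) (suc D)
  frac≤2/k+1/D a d k D cross = ℚP.toℚᵘ-cancel-≤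
    (ℚᵘP.≤-respˡ-≃ (ℚᵘP.≃-sym (frac≃ a d)) (ℚᵘP.≤-respʳ-≃ (ℚᵘP.≃-sym sum≃) (*≤* cross′)))
    where
    sum≃ : toℚᵘ (frac (+ 2) (suc k) ℚ.+ frac (+ 1) (suc D)) ℚᵘ.≃ mkℚᵘ (+ 2) k ℚᵘ.+ mkℚᵘ (+ 1) D
    sum≃ = ℚᵘP.≃-trans (ℚP.toℚᵘ-homo-+ (frac (+ 2) (suc k)) (frac (+ 1) (suc D)))
             (ℚᵘP.+-cong (frac≃ (+ 2) k) (frac≃ (+ 1) D))
    rhs-numerator : + ((2 ℕ.* suc D ℕ.+ suc k) ℕ.* suc d) ≡ (+ 2 ℤ.* + suc D ℤ.+ + 1 ℤ.* + suc k) ℤ.* + suc d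
    rhs-numerator = trans (ℤP.pos-* (2 ℕ.* suc D ℕ.+ suc k) (suc d))
      (cong (ℤ._* + suc d) (trans (ℤP.pos-+ (2 ℕ.* suc D) (suc k))
        (cong₂ ℤ._+_ (ℤP.pos-* 2 (suc D)) (sym (ℤP.*-identityˡ (+ suc k))))))
    cross′ : a ℤ.* + (suc k ℕ.* suc D) ℤ.≤ (+ 2 ℤ.* + suc D ℤ.+ + 1 ℤ.* + suc k) ℤ.* + suc d
    cross′ = subst (a ℤ.* + (suc k ℕ.* suc D) ℤ.≤_) rhs-numerator cross

  1/denominator≤ : (η : ℚ) → 0ℚ ℚ.< η → frac (+ 1) (↧ₙ η) ℚ.≤ η
  1/denominator≤ (mkℚ (+ 0) _ _)      (ℚ.*<* (ℤ.+<+ ()))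
  1/denominator≤ (mkℚ -[1+ _ ] _ _)   (ℚ.*<* ())
  1/denominator≤ (mkℚ +[1+ N ] D _) _ =
    ℚP.toℚᵘ-cancel-≤ (ℚᵘP.≤-respˡ-≃ (ℚᵘP.≃-sym (frac≃ (+ 1) D)) (*≤* (subst₂ ℤ._≤_ (ℤP.pos-* 1 (suc D)) (ℤP.pos-* (suc N) (suc D))
      (ℤ.+≤+ (ℕP.*-monoˡ-≤ (suc D) (ℕ.s≤s (ℕ.z≤n {N})))))))


module Density where

  open import Defs
  open Combinatorics
  open Arithmetic
  open Rationals
  open import Data.Nat using (ℕ; zero; suc; _≤_; _<_; s≤s; _+_; _*_; _∸_; _≤?_)
  import Data.Nat.Properties as ℕP
  open import Data.Integer as ℤ using (+_; -[1+_])
  import Data.Integer.Properties as ℤP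
  import Data.Rational as ℚ
  open import Data.Fin.Subset using (_∈_; ∣_∣)
  open import Data.Fin.Subset.Properties using (_∈?_)
  open import Data.List using (length)
  import Data.List.Relation.Unary.All as All
  open import Data.Product using (∃; _×_; _,_)
  open import Relation.Nullary using (yes; no)
  open import Relation.Binary.PropositionalEquality using (_≡_; refl; sym; trans; cong; subst; subst₂)

  -- the girth threshold: exceeds the number of edges of any sub-hypergraph
  -- with fewer than k + (k + 1)·D vertices
  girth-threshold : ℕ → ℕ → ℕ
  girth-threshold k D = suc (2 * (k + suc k * D) + k * k)

  above : ∀ {k w} → k < w → ∃ λ d → w ∸ k ≡ suc d × w ≡ k + suc d
  above {zero}  {suc w} _         = w , refl , refl
  above {suc k} {suc w} (s≤s k<w) = let (d , w∸k≡ , w≡) = above k<w in d , w∸k≡ , cong suc w≡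

  module _ {k' n : ℕ} (D : ℕ) (1≤k' : 1 ≤ k') (H : Hypergraph (suc k') n) (absorber : IsContractedAbsorber H)
           (girth : GirthAtLeast H (girth-threshold (suc k') D)) (H' : SubHypergraph H) where

    k : ℕ
    k = suc k'

    degree-count : ∀ f d → length (F H') ≡ suc f → ∣ W H' ∣ ≡ k + suc d →
      suc f * k ≤ 2 * (k + suc d) + k * k
    degree-count f d |F'| |W'| = subst₂ (λ e w → e * k ≤ 2 * w + k * k) |F'| |W'|
      (ContractedAbsorber.edge-count-bound H absorber H')

    numerator-bound : ∀ f d → length (F H') ≡ suc f → ∣ W H' ∣ ≡ k + suc d →
      f * (k * D) ≤ (2 * D + k) * suc d
    numerator-bound f d |F'| |W'| with suc k * D ≤? suc d
    ... | yes dense  = dense-bound k D (suc d) f dense (degree-count f d |F'| |W'|)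
    ... | no  sparse = sparse-bound k' D (suc d) f 1≤k' forest-count
      where
      -- few vertices force few edges, below the girth: H' is acyclic
      few-edges : length (F H') < girth-threshold k D
      few-edges = s≤s (begin
        length (F H')                   ≡⟨ |F'| ⟩
        suc f                           ≤⟨ ℕP.m≤m*n (suc f) k ⟩
        suc f * k                       ≤⟨ degree-count f d |F'| |W'| ⟩
        2 * (k + suc d) + k * k         ≤⟨ ℕP.+-monoˡ-≤ (k * k) (ℕP.*-monoʳ-≤ 2 (ℕP.+-monoʳ-≤ k
                                             (ℕP.<⇒≤ (ℕP.≰⇒> sparse)))) ⟩
        2 * (k + suc k * D) + k * k     ∎)
        where open ℕP.≤-Reasoning
      acyclic : Acyclic (F H')
      acyclic ℓ ℓ≤|F'| cycle = girth ℓ (ℕP.≤-<-trans ℓ≤|F'| few-edges)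
        (cycle⇒bergeCycle H (cycle-mono (All.lookup (F-sub H')) cycle))
      forest-count : k' * suc f + 1 ≤ k + suc d
      forest-count = subst (k' * suc f + 1 ≤_) (trans (∑-∈ (W H')) |W'|)
        (forest-bound k' f (F H') (_∈ W H') (_∈? W H') |F'| (F-unique H') (subgraph-uniform H') (F-in-W H') acyclic)

  density-bound : ∀ {k n} (D : ℕ) → 2 ≤ k → (H : Hypergraph k n) → IsContractedAbsorber H →
    GirthAtLeast H (girth-threshold k (suc D)) → kDensityAtMost H (frac (+ 2) k ℚ.+ frac (+ 1) (suc D))
  density-bound {suc k'} D (s≤s 1≤k') H absorber girth H' k<|W'| with above k<|W'|
  ... | d , |W'|∸k≡ , |W'|≡ =
    subst (λ m → frac (+ length (F H') ℤ.- + 1) m ℚ.≤ bound) (sym |W'|∸k≡) (by-edge-count (length (F H')) refl)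
    where
    bound : ℚ.ℚ
    bound = frac (+ 2) (suc k') ℚ.+ frac (+ 1) (suc D)
    -- no edges: the numerator is -1; otherwise use the numerator bound
    by-edge-count : ∀ f → length (F H') ≡ f → frac (+ f ℤ.- + 1) (suc d) ℚ.≤ bound
    by-edge-count zero    _    = frac≤2/k+1/D -[1+ 0 ] d k' D ℤ.-≤+
    by-edge-count (suc f) |F'| = frac≤2/k+1/D (+ f) d k' D
      (subst (ℤ._≤ _) (ℤP.pos-* f (suc k' * suc D))
        (ℤ.+≤+ (numerator-bound (suc D) 1≤k' H absorber girth H' f d |F'| |W'|≡)))


open import Defs
open import Data.Nat using (ℕ; _≤_; _<_)
open import Data.Integer using (+_)
open import Data.Product using (Σ; _×_)
open import Data.Rational using (ℚ; 0ℚ; _+_) renaming (_<_ to _<ℚ_; _≤_ to _≤ℚ_)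

open import Data.Nat using (suc; s≤s; z≤n)
open import Data.Product using (_,_)
import Data.Rational.Properties as ℚP
open Density using (girth-threshold; density-bound)
open Rationals using (1/denominator≤)

-- With D the denominator of η, K = K(k, D) works: m_k(H) ≤ 2/k + 1/D ≤ 2/k + η.
lemma8p3 : (η : ℚ) → 0ℚ <ℚ η → (k : ℕ) → 2 ≤ k →
    Σ ℕ λ K → 0 < K ×
      ((n : ℕ) (H : Hypergraph k n) → IsContractedAbsorber H → GirthAtLeast H K →
        kDensityAtMost H (frac (+ 2) k + η))
lemma8p3 η 0<η k 2≤k =
  girth-threshold k (suc (ℚ.denominator-1 η)) , s≤s z≤n ,
  λ n H absorber girth H' k<|W'| →
    ℚP.≤-trans (density-bound (ℚ.denominator-1 η) 2≤k H absorber girth H' k<|W'|)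
               (ℚP.+-monoʳ-≤ (frac (+ 2) k) (1/denominator≤ η 0<η))
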